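{- The poset $\mathsf{T}_n$ is graded of rank $\binom{n+1}{2}-1$, i.e. it has a unique minimal and a unique maximal element and all maximal chains have cardinality $\binom{n+1}{2}$.
   Context: For nonempty $A,B\subseteq[n]$, write $A(k)$ for the $k$-th smallest element of $A$. The tableau order: $A\sqsubseteq B$ iff $\#A\ge\#B$ and $A(k)\le B(k)$ for all $k\le\#B$ (equivalently $A,B$ are the first and second column entry sets of a two-column semistandard tableau). $\mathsf{T}_n=(2^{[n]}\setminus\{\varnothing\},\sqsubseteq)$. -}

module Defs where

open import Data.Nat using (ℕ; zero; suc; _≤_)
open import Data.Fin using (Fin; toℕ; inject≤) renaming (zero to fzero; suc to fsuc)
open import Data.Fin.Subset using (Subset; Nonempty; inside; outside)
open import Data.Vec using ([]; _∷_)
open import Data.List using (List; []; _∷_; map; length; lookup)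
open import Data.List.Relation.Unary.Linked using (Linked)
open import Data.List.Relation.Unary.Any using (Any)
open import Data.Product using (Σ; ∃; _×_; proj₁)
open import Relation.Binary.PropositionalEquality using (_≡_; _≢_)

elems : ∀ {n} → Subset n → List (Fin n)
elems [] = []
elems (inside ∷ p) = fzero ∷ map fsuc (elems p)
elems (outside ∷ p) = map fsuc (elems p)

card : ∀ {n} → Subset n → ℕ
card A = length (elems A)

-- A(k), the (k+1)-th smallest element (0-indexed k)
at : ∀ {n} (A : Subset n) → Fin (card A) → Fin n
at A k = lookup (elems A) k

T : ℕ → Set
T n = Σ (Subset n) Nonempty

_≈T_ : ∀ {n} → T n → T n → Set
A ≈T B = proj₁ A ≡ proj₁ B

_⊑ₛ_ : ∀ {n} → Subset n → Subset n → Set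
A ⊑ₛ B = Σ (card B ≤ card A) λ h →
           ∀ (k : Fin (card B)) → toℕ (at A (inject≤ k h)) ≤ toℕ (at B k)

_⊑_ : ∀ {n} → T n → T n → Set
A ⊑ B = proj₁ A ⊑ₛ proj₁ B

_⊏_ : ∀ {n} → T n → T n → Set
A ⊏ B = A ⊑ B × (proj₁ A ≢ proj₁ B)

Minimal : ∀ {n} → T n → Set
Minimal m = ∀ x → x ⊑ m → x ≈T m

Maximal : ∀ {n} → T n → Set
Maximal m = ∀ x → m ⊑ x → x ≈T m

Chain : ∀ {n} → List (T n) → Set
Chain c = Linked _⊏_ c

_∈C_ : ∀ {n} → T n → List (T n) → Set
x ∈C c = Any (x ≈T_) c

MaximalChain : ∀ {n} → List (T n) → Set
MaximalChain {n} c = Chain c ×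
  (∀ (c' : List (T n)) → Chain c' → (∀ x → x ∈C c → x ∈C c') → ∀ x → x ∈C c' → x ∈C c)

-- Give the element i of [n] the weight n + 1 − i and a subset the total weight of its elements.
-- A ⊑ B says that every initial segment of [n] contains at least as many elements of A as of B,
-- so the weight drops strictly along ⊏; [n] (weight C(n+1,2)) is the least and {n} (weight 1) the
-- greatest element of T_n. If A ⊏ B, let i be the first element of A not in B and move the last
-- element of the run of A starting at i one place up (dropping it if it is n): this gives
-- A ⊑ C ⊑ B with weight C = weight A − 1. Hence consecutive members of a maximal chain differ in
-- weight by exactly one, and a maximal chain runs from [n] to {n}, so it has C(n+1,2) elements.
module Submission where

open import Data.Nat using (ℕ; zero; suc; _+_; _*_; _≤_; _<_; _>_; _≤?_; z≤n; s≤s; s≤s⁻¹)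
open import Data.Nat.Properties
open import Data.Nat.Combinatorics using (_C_; nC1≡n; nCk+nC[k+1]≡[n+1]C[k+1])
open import Data.Nat.Tactic.RingSolver using (solve-∀)
open import Data.Fin using (Fin; fromℕ; inject≤; _≥_) renaming (zero to fzero; suc to fsuc)
open import Data.Fin.Subset using (Subset; inside; outside; ⊤; ⁅_⁆; Nonempty)
open import Data.Fin.Subset.Properties using (x∈⁅x⁆)
open import Data.Vec using ([]; _∷_; here; there)
open import Data.List using (List; []; _∷_; _++_; _∷ʳ_; map; drop; length; lookup; initLast; _∷ʳ′_)
open import Data.List.Properties using (map-++; length-map; ++-assoc; drop-map; drop-[])
open import Data.List.Membership.Propositional using (_∈_)
open import Data.List.Relation.Unary.Any using (Any; here; there)
import Data.List.Relation.Unary.Any as Any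
open import Data.List.Relation.Unary.Any.Properties using (++⁺ˡ; ++⁺ʳ; ++⁻)
import Data.List.Relation.Unary.Any.Properties as Anyₚ
open import Data.List.Relation.Unary.All using (All; []; _∷_)
import Data.List.Relation.Unary.All as All
import Data.List.Relation.Unary.All.Properties as Allₚ
open import Data.List.Relation.Unary.Linked using (Linked; []; [-]; _∷_)
import Data.List.Relation.Unary.Linked as Linked
import Data.List.Relation.Unary.Linked.Properties as Linkedₚ
open import Data.List.Relation.Binary.Prefix.Heterogeneous as Prefix using (Prefix; []; _∷_)
import Data.List.Relation.Binary.Prefix.Heterogeneous.Properties as Prefixₚ
open import Data.Unit using (tt) renaming (⊤ to True)
open import Data.Empty using (⊥; ⊥-elim)
open import Data.Product using (Σ; ∃; _×_; _,_; proj₁; proj₂)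
open import Data.Sum using (_⊎_; inj₁; inj₂; [_,_])
open import Function using (_∘_; _⇔_; mk⇔; Equivalence)
open import Function.Construct.Composition using (_⇔-∘_)
open import Function.Properties.Equivalence using () renaming (sym to ⇔-sym)
open import Relation.Nullary using (¬_; yes; no; contradiction)
open import Relation.Binary.PropositionalEquality
  using (_≡_; _≢_; refl; sym; trans; cong; cong₂; subst; module ≡-Reasoning)

private variable
  A B : Set
  R : A → B → Set
  a b x y : A
  xs ys : List A
  m n : ℕ

linked-split : ∀ xs → Linked R (xs ++ a ∷ b ∷ ys) → R a b
linked-split [] (r ∷ _) = r
linked-split (_ ∷ []) (_ ∷ l) = linked-split [] l
linked-split (_ ∷ xs@(_ ∷ _)) (_ ∷ l) = linked-split xs l

linked-insert : ∀ xs {z} → Linked R (xs ++ a ∷ b ∷ ys) → R a z → R z b →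
  Linked R (xs ++ a ∷ z ∷ b ∷ ys)
linked-insert [] (_ ∷ l) az zb = az ∷ zb ∷ l
linked-insert (_ ∷ []) (r ∷ l) az zb = r ∷ linked-insert [] l az zb
linked-insert (_ ∷ xs@(_ ∷ _)) (r ∷ l) az zb = r ∷ linked-insert xs l az zb

linked-∷ʳ : ∀ xs → Linked R (xs ∷ʳ x) → R x y → Linked R (xs ∷ʳ x ∷ʳ y)
linked-∷ʳ [] [-] r = r ∷ [-]
linked-∷ʳ (_ ∷ []) (r ∷ l) r′ = r ∷ linked-∷ʳ [] l r′
linked-∷ʳ (_ ∷ xs@(_ ∷ _)) (r ∷ l) r′ = r ∷ linked-∷ʳ xs l r′

any-insert : {P : A → Set} → ∀ xs {z} → Any P (xs ++ a ∷ b ∷ ys) → Any P (xs ++ a ∷ z ∷ b ∷ ys)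
any-insert xs p = [ ++⁺ˡ , ++⁺ʳ xs ∘ skip ] (++⁻ xs p)
  where
  skip : ∀ {P : A → Set} {a b z ys} → Any P (a ∷ b ∷ ys) → Any P (a ∷ z ∷ b ∷ ys)
  skip (here p) = here p
  skip (there p) = there (there p)

linked-by-splits : {P : List A → Set} →
  (∀ xs {a b} ys → P (xs ++ a ∷ b ∷ ys) → R a b) → ∀ {zs} → P zs → Linked R zs
linked-by-splits {A = A} {R = R} {P = P} split = go []
  where
  go : ∀ xs {zs} → P (xs ++ zs) → Linked R zs
  go xs {[]} _ = []
  go xs {_ ∷ []} _ = [-]
  go xs {a ∷ b ∷ zs} p =
    split xs zs p ∷ go (xs ∷ʳ a) (subst P (sym (++-assoc xs (a ∷ []) (b ∷ zs))) p)

Descending : List ℕ → Set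
Descending = Linked _>_

descending-head-max : ∀ {m n ns} → Descending (n ∷ ns) → m ∈ n ∷ ns → m ≤ n
descending-head-max _ (here refl) = ≤-refl
descending-head-max (n>n′ ∷ d) (there m∈) = ≤-trans (descending-head-max d m∈) (<⇒≤ n>n′)

descending-gap : ∀ {m n n′ ns ns′} → Descending (ns ++ n ∷ n′ ∷ ns′) →
  m ∈ ns ++ n ∷ n′ ∷ ns′ → n ≤ m ⊎ m ≤ n′
descending-gap {ns = []} _ (here refl) = inj₁ ≤-refl
descending-gap {ns = []} (_ ∷ d) (there m∈) = inj₂ (descending-head-max d m∈)
descending-gap {ns = _ ∷ ns} d (here refl) = inj₁ (descending-head-max d (there (++⁺ʳ ns (here refl))))
descending-gap {ns = _ ∷ _} d (there m∈) = descending-gap (Linked.tail d) m∈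

countdown-length : ∀ {m n ns} → Linked (λ i j → i ≡ suc j) (n ∷ ns) →
  m ∈ n ∷ ns → All (m ≤_) (n ∷ ns) → length (n ∷ ns) + m ≡ suc n
countdown-length [-] (here refl) _ = refl
countdown-length (refl ∷ _) (here refl) (_ ∷ m≤n′ ∷ _) = contradiction m≤n′ (n≮n _)
countdown-length (refl ∷ d) (there m∈) (_ ∷ ms) = cong suc (countdown-length d m∈ ms)

module WeightedPoset
  {X : Set} (_≈_ _⊑_ : X → X → Set) (w : X → ℕ)
  (≈-refl : ∀ {x} → x ≈ x)
  (w-resp : ∀ {x y} → x ≈ y → w x ≡ w y)
  (w-antitone : ∀ {x y} → x ⊑ y → w y ≤ w x)
  (w-reflects : ∀ {x y} → x ⊑ y → w x ≤ w y → x ≈ y)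
  where

  -- At T n these are definitionally the notions of Defs.
  _⊏_ : X → X → Set
  x ⊏ y = x ⊑ y × ¬ x ≈ y

  Minimal Maximal : X → Set
  Minimal m = ∀ x → x ⊑ m → x ≈ m
  Maximal m = ∀ x → m ⊑ x → x ≈ m

  Chain : List X → Set
  Chain = Linked _⊏_

  _∈C_ : X → List X → Set
  x ∈C c = Any (x ≈_) c

  MaximalChain : List X → Set
  MaximalChain c = Chain c ×
    (∀ c′ → Chain c′ → (∀ x → x ∈C c → x ∈C c′) → ∀ x → x ∈C c′ → x ∈C c)

  w-strict : ∀ {x y} → x ⊏ y → w y < w x
  w-strict (x⊑y , x≉y) = ≤∧≢⇒< (w-antitone x⊑y) (x≉y ∘ w-reflects x⊑y ∘ ≤-reflexive ∘ sym)

  ⊑⇒≈⊎⊏ : ∀ {x y} → x ⊑ y → x ≈ y ⊎ x ⊏ y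
  ⊑⇒≈⊎⊏ {x} {y} x⊑y with w x ≤? w y
  ... | yes wx≤wy = inj₁ (w-reflects x⊑y wx≤wy)
  ... | no wx≰wy = inj₂ (x⊑y , wx≰wy ∘ ≤-reflexive ∘ w-resp)

  chain-descending : ∀ {c} → Chain c → Descending (map w c)
  chain-descending = Linkedₚ.map⁺ ∘ Linked.map w-strict

  ∈C⇒weight∈ : ∀ {x c} → x ∈C c → w x ∈ map w c
  ∈C⇒weight∈ = Anyₚ.map⁺ ∘ Any.map w-resp

  module Bounded
    (bot top : X) (bot-least : ∀ x → bot ⊑ x) (top-greatest : ∀ x → x ⊑ top)
    (cover : ∀ {a b} → a ⊏ b → ∃ λ z → a ⊑ z × z ⊑ b × suc (w z) ≡ w a)
    where

    bot-minimal : Minimal bot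
    bot-minimal x x⊑bot = w-reflects x⊑bot (w-antitone (bot-least x))

    top-maximal : Maximal top
    top-maximal x top⊑x = w-reflects (top-greatest x) (w-antitone top⊑x)

    bot∈maximalChain : ∀ {c} → MaximalChain c → w bot ∈ map w c
    bot∈maximalChain {[]} (_ , maximal)
      with () ← maximal (bot ∷ []) [-] (λ _ ()) bot (here ≈-refl)
    bot∈maximalChain {h ∷ c} (chain , maximal) with ⊑⇒≈⊎⊏ (bot-least h)
    ... | inj₁ bot≈h = here (w-resp bot≈h)
    ... | inj₂ bot⊏h = ∈C⇒weight∈
      (maximal (bot ∷ h ∷ c) (bot⊏h ∷ chain) (λ _ → there) bot (here ≈-refl))

    top∈maximalChain : ∀ {c} → MaximalChain c → w top ∈ map w c
    top∈maximalChain {c} max@(chain , maximal) with initLast c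
    ... | [] with () ← bot∈maximalChain max
    ... | c′ ∷ʳ′ l with ⊑⇒≈⊎⊏ (top-greatest l)
    ...   | inj₁ l≈top = Anyₚ.map⁺ (++⁺ʳ c′ (here (sym (w-resp l≈top))))
    ...   | inj₂ l⊏top = ∈C⇒weight∈
      (maximal (c ∷ʳ top) (linked-∷ʳ c′ chain l⊏top) (λ _ → ++⁺ˡ) top
               (++⁺ʳ c (here ≈-refl)))

    maximalChain-step : ∀ cs {a b} cs′ → MaximalChain (cs ++ a ∷ b ∷ cs′) → w a ≡ suc (w b)
    maximalChain-step cs {a} {b} cs′ (chain , maximal)
      with z , a⊑z , z⊑b , wz+1≡wa ← cover (linked-split cs chain)
      with ⊑⇒≈⊎⊏ z⊑b
    ... | inj₁ z≈b = trans (sym wz+1≡wa) (cong suc (w-resp z≈b))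
    ... | inj₂ z⊏b = ⊥-elim ([ <⇒≱ wz<wa , <⇒≱ (w-strict z⊏b) ] gap)
      where
      wz<wa : w z < w a
      wz<wa = ≤-reflexive wz+1≡wa
      a⊏z : a ⊏ z
      a⊏z = a⊑z , λ a≈z → 1+n≢n (trans wz+1≡wa (w-resp a≈z))
      z∈c : z ∈C (cs ++ a ∷ b ∷ cs′)
      z∈c = maximal _ (linked-insert cs chain a⊏z z⊏b) (λ _ → any-insert cs) z (++⁺ʳ cs (there (here ≈-refl)))
      split : map w (cs ++ a ∷ b ∷ cs′) ≡ map w cs ++ w a ∷ w b ∷ map w cs′
      split = map-++ w cs (a ∷ b ∷ cs′)
      gap : w a ≤ w z ⊎ w z ≤ w b
      gap = descending-gap (subst Descending split (chain-descending chain))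
                           (subst (w z ∈_) split (∈C⇒weight∈ z∈c))

    maximalChain-length : ∀ c → MaximalChain c → length c + w top ≡ suc (w bot)
    maximalChain-length [] max with () ← bot∈maximalChain max
    maximalChain-length c@(h ∷ _) max@(chain , _) = begin
      length c + w top         ≡⟨ cong (_+ w top) (sym (length-map w c)) ⟩
      length (map w c) + w top ≡⟨ countdown-length steps (top∈maximalChain max) above-top ⟩
      suc (w h)                ≡⟨ cong suc (≤-antisym (w-antitone (bot-least h)) below-h) ⟩
      suc (w bot)              ∎
      where
      open ≡-Reasoning
      steps : Linked (λ i j → i ≡ suc j) (map w c)
      steps = Linkedₚ.map⁺ (linked-by-splits {P = MaximalChain} maximalChain-step max)
      above-top : All (w top ≤_) (map w c)
      above-top = Allₚ.map⁺ (All.universal (w-antitone ∘ top-greatest) c)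
      below-h : w bot ≤ w h
      below-h = descending-head-max (chain-descending chain) (bot∈maximalChain max)

-- Dominates k A B: every initial segment of [m] contains at most k more elements of B than of A.
Dominates : ℕ → Subset m → Subset m → Set
Dominates k [] [] = True
Dominates k (inside ∷ A) (inside ∷ B) = Dominates k A B
Dominates k (outside ∷ A) (outside ∷ B) = Dominates k A B
Dominates k (inside ∷ A) (outside ∷ B) = Dominates (suc k) A B
Dominates zero (outside ∷ A) (inside ∷ B) = ⊥
Dominates (suc k) (outside ∷ A) (inside ∷ B) = Dominates k A B

weight : Subset m → ℕ
weight [] = 0
weight {suc m} (inside ∷ A) = suc m + weight A
weight (outside ∷ A) = weight A

dominates-refl : ∀ k (A : Subset m) → Dominates k A A
dominates-refl k [] = tt
dominates-refl k (inside ∷ A) = dominates-refl k A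
dominates-refl k (outside ∷ A) = dominates-refl k A

bound-widen : ∀ {a b} k m → b ≤ a + k * m → b ≤ a + k * suc m
bound-widen {a} k m b≤ = ≤-trans b≤ (+-monoʳ-≤ a (*-monoʳ-≤ k (n≤1+n m)))

bound-cons : ∀ {a b} k m → b ≤ a + k * m → suc m + b ≤ suc m + a + k * suc m
bound-cons {a} k m b≤ =
  ≤-trans (+-monoʳ-≤ (suc m) (bound-widen k m b≤)) (≤-reflexive (sym (+-assoc (suc m) a (k * suc m))))

+-suc-*-rearrange : ∀ a k n → a + suc k * n ≡ n + a + k * n
+-suc-*-rearrange = solve-∀

weight-bound : ∀ k (A B : Subset m) → Dominates k A B → weight B ≤ weight A + k * m
weight-bound k [] [] _ = z≤n
weight-bound {suc m} k (inside ∷ A) (inside ∷ B) d = bound-cons k m (weight-bound k A B d)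
weight-bound {suc m} k (outside ∷ A) (outside ∷ B) d = bound-widen k m (weight-bound k A B d)
weight-bound {suc m} k (inside ∷ A) (outside ∷ B) d =
  ≤-trans (bound-widen (suc k) m (weight-bound (suc k) A B d))
          (≤-reflexive (+-suc-*-rearrange (weight A) k (suc m)))
weight-bound {suc m} (suc k) (outside ∷ A) (inside ∷ B) d =
  ≤-trans (bound-cons k m (weight-bound k A B d))
          (≤-reflexive (sym (+-suc-*-rearrange (weight A) k (suc m))))

weight-antitone : (A B : Subset m) → Dominates 0 A B → weight B ≤ weight A
weight-antitone A B d = ≤-trans (weight-bound 0 A B d) (≤-reflexive (+-identityʳ (weight A)))

dominates∧weight-≤⇒≡ : (A B : Subset m) → Dominates 0 A B → weight A ≤ weight B → A ≡ B
dominates∧weight-≤⇒≡ [] [] _ _ = refl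
dominates∧weight-≤⇒≡ {suc m} (inside ∷ A) (inside ∷ B) d w≤ =
  cong (inside ∷_) (dominates∧weight-≤⇒≡ A B d (+-cancelˡ-≤ (suc m) _ _ w≤))
dominates∧weight-≤⇒≡ (outside ∷ A) (outside ∷ B) d w≤ =
  cong (outside ∷_) (dominates∧weight-≤⇒≡ A B d w≤)
dominates∧weight-≤⇒≡ {suc m} (inside ∷ A) (outside ∷ B) d w≤ = ⊥-elim (n≮n (m + weight A) (begin-strict
  m + weight A      <⟨ ≤-refl ⟩
  suc m + weight A  ≤⟨ w≤ ⟩
  weight B          ≤⟨ weight-bound 1 A B d ⟩
  weight A + 1 * m  ≡⟨ cong (weight A +_) (*-identityˡ m) ⟩
  weight A + m      ≡⟨ +-comm (weight A) m ⟩
  m + weight A      ∎))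
  where open ≤-Reasoning

-- inside ∷ A with the last element of its leading run moved up one place (dropped if it is last)
advanceRun : Subset m → Subset (suc m)
advanceRun [] = outside ∷ []
advanceRun (inside ∷ A) = inside ∷ advanceRun A
advanceRun (outside ∷ A) = outside ∷ inside ∷ A

weight-advanceRun : (A : Subset m) → suc (weight (advanceRun A)) ≡ weight (inside ∷ A)
weight-advanceRun [] = refl
weight-advanceRun {suc m} (inside ∷ A) =
  trans (sym (+-suc (suc (suc m)) _)) (cong (suc (suc m) +_) (weight-advanceRun A))
weight-advanceRun (outside ∷ A) = refl

dominates-advanceRun : ∀ k (A : Subset m) → Dominates k (inside ∷ A) (advanceRun A)
dominates-advanceRun k [] = tt
dominates-advanceRun k (inside ∷ A) = dominates-advanceRun k A
dominates-advanceRun k (outside ∷ A) = dominates-refl k A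

advanceRun-dominates-outside : ∀ k (A B : Subset m) →
  Dominates k (inside ∷ A) (outside ∷ B) → Dominates k (advanceRun A) (outside ∷ B)
advanceRun-dominates-inside : ∀ k (A B : Subset m) →
  Dominates (suc k) (inside ∷ A) (inside ∷ B) → Dominates (suc k) (advanceRun A) (inside ∷ B)
advanceRun-dominates-outside k [] [] _ = tt
advanceRun-dominates-outside k (inside ∷ A) (inside ∷ B) d = advanceRun-dominates-inside k A B d
advanceRun-dominates-outside k (inside ∷ A) (outside ∷ B) d = advanceRun-dominates-outside (suc k) A B d
advanceRun-dominates-outside k (outside ∷ A) (inside ∷ B) d = d
advanceRun-dominates-outside k (outside ∷ A) (outside ∷ B) d = d
advanceRun-dominates-inside k [] [] _ = tt
advanceRun-dominates-inside k (inside ∷ A) (inside ∷ B) d = advanceRun-dominates-inside k A B d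
advanceRun-dominates-inside k (inside ∷ A) (outside ∷ B) d = advanceRun-dominates-outside (suc k) A B d
advanceRun-dominates-inside k (outside ∷ A) (inside ∷ B) d = d
advanceRun-dominates-inside k (outside ∷ A) (outside ∷ B) d = d

cover : (A B : Subset m) → Dominates 0 A B → A ≢ B →
  Σ (Subset m) λ Z → Dominates 0 A Z × Dominates 0 Z B × suc (weight Z) ≡ weight A
cover [] [] _ A≢B = ⊥-elim (A≢B refl)
cover {suc m} (inside ∷ A) (inside ∷ B) d A≢B with Z , AZ , ZB , e ← cover A B d (A≢B ∘ cong (inside ∷_)) =
  inside ∷ Z , AZ , ZB , trans (sym (+-suc (suc m) (weight Z))) (cong (suc m +_) e)
cover (outside ∷ A) (outside ∷ B) d A≢B with Z , AZ , ZB , e ← cover A B d (A≢B ∘ cong (outside ∷_)) =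
  outside ∷ Z , AZ , ZB , e
cover (inside ∷ A) (outside ∷ B) d _ =
  advanceRun A , dominates-advanceRun 0 A , advanceRun-dominates-outside 0 A B d , weight-advanceRun A

dominates-nonempty : (A B : Subset m) → Dominates 0 A B → Nonempty B → Nonempty A
dominates-nonempty (inside ∷ A) B _ _ = fzero , here
dominates-nonempty (outside ∷ A) (outside ∷ B) d (fsuc i , there i∈B)
  with j , j∈A ← dominates-nonempty A B d (i , i∈B) = fsuc j , there j∈A

⊤-dominates : ∀ k (B : Subset m) → Dominates k ⊤ B
⊤-dominates k [] = tt
⊤-dominates k (inside ∷ B) = ⊤-dominates k B
⊤-dominates k (outside ∷ B) = ⊤-dominates (suc k) B

dominates-⁅last⁆ : ∀ k (A : Subset (suc m)) → Dominates (suc k) A ⁅ fromℕ m ⁆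
dominates-⁅last⁆ {zero} k (inside ∷ []) = tt
dominates-⁅last⁆ {zero} k (outside ∷ []) = tt
dominates-⁅last⁆ {suc m} k (inside ∷ A) = dominates-⁅last⁆ (suc k) A
dominates-⁅last⁆ {suc m} k (outside ∷ A) = dominates-⁅last⁆ k A

nonempty-dominates-⁅last⁆ : ∀ k (A : Subset (suc m)) → Nonempty A → Dominates k A ⁅ fromℕ m ⁆
nonempty-dominates-⁅last⁆ {zero} k (inside ∷ []) _ = tt
nonempty-dominates-⁅last⁆ {zero} k (outside ∷ []) (fzero , ())
nonempty-dominates-⁅last⁆ {suc m} k (inside ∷ A) _ = dominates-⁅last⁆ k A
nonempty-dominates-⁅last⁆ {suc m} k (outside ∷ A) (fsuc i , there i∈A) =
  nonempty-dominates-⁅last⁆ k A (i , i∈A)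

weight-⊤ : ∀ n → weight (⊤ {n}) ≡ suc n C 2
weight-⊤ zero = refl
weight-⊤ (suc n) = begin
  suc n + weight (⊤ {n})    ≡⟨ cong₂ _+_ (sym (nC1≡n (suc n))) (weight-⊤ n) ⟩
  suc n C 1 + suc n C 2     ≡⟨ nCk+nC[k+1]≡[n+1]C[k+1] (suc n) 1 ⟩
  suc (suc n) C 2           ∎
  where open ≡-Reasoning

weight-⁅last⁆ : ∀ m → weight ⁅ fromℕ m ⁆ ≡ 1
weight-⁅last⁆ zero = refl
weight-⁅last⁆ (suc m) = weight-⁅last⁆ m

prefix⇒lookup : ∀ {xs ys} → Prefix R xs ys →
  Σ (length xs ≤ length ys) λ h → ∀ k → R (lookup xs k) (lookup ys (inject≤ k h))
prefix⇒lookup [] = z≤n , λ ()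
prefix⇒lookup (r ∷ rs) with h , f ← prefix⇒lookup rs = s≤s h , λ { fzero → r ; (fsuc k) → f k }

lookup⇒prefix : ∀ {xs ys} →
  (Σ (length xs ≤ length ys) λ h → ∀ k → R (lookup xs k) (lookup ys (inject≤ k h))) → Prefix R xs ys
lookup⇒prefix {xs = []} _ = []
lookup⇒prefix {xs = _ ∷ _} {_ ∷ _} (s≤s h , f) = f fzero ∷ lookup⇒prefix (h , f ∘ fsuc)

Above : List (Fin n) → List (Fin n) → Set
Above = Prefix _≥_

above-map-suc : ∀ {xs ys : List (Fin n)} → Above (map fsuc xs) (map fsuc ys) ⇔ Above xs ys
above-map-suc = mk⇔ (Prefix.map s≤s⁻¹ ∘ Prefixₚ.map⁻ fsuc fsuc) (Prefixₚ.map⁺ fsuc fsuc ∘ Prefix.map s≤s)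

above-∷ : ∀ {x : Fin (suc n)} {xs ys} → Above (x ∷ xs) (fzero ∷ ys) ⇔ Above xs ys
above-∷ = mk⇔ Prefix.tail (z≤n ∷_)

above-drop-map-suc : ∀ k (xs ys : List (Fin n)) →
  Above (drop k (map fsuc xs)) (map fsuc ys) ⇔ Above (drop k xs) ys
above-drop-map-suc k xs ys rewrite drop-map {f = fsuc} k xs = above-map-suc

above-drop-zero∷ : ∀ k (xs ys : List (Fin n)) →
  Above (drop k (map fsuc xs)) (fzero ∷ map fsuc ys) ⇔ Above (drop (suc k) xs) ys
above-drop-zero∷ zero [] ys = mk⇔ (λ _ → []) (λ _ → [])
above-drop-zero∷ zero (x ∷ xs) ys = above-map-suc ⇔-∘ above-∷
above-drop-zero∷ (suc k) [] ys = mk⇔ (λ _ → []) (λ _ → [])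
above-drop-zero∷ (suc k) (x ∷ xs) ys = above-drop-zero∷ k xs ys

¬above-zero∷ : ∀ {xs : List (Fin (suc n))} {ys : List (Fin n)} → ¬ Above (fzero ∷ xs) (map fsuc ys)
¬above-zero∷ {ys = _ ∷ _} (() ∷ _)

open import Defs

dominates⇔above : ∀ k (A B : Subset n) → Dominates k A B ⇔ Above (drop k (elems B)) (elems A)
dominates⇔above k [] [] = mk⇔ (λ _ → subst (λ bs → Above bs []) (sym (drop-[] k)) []) (λ _ → tt)
dominates⇔above zero (inside ∷ A) (inside ∷ B) =
  ⇔-sym (above-map-suc ⇔-∘ above-∷) ⇔-∘ dominates⇔above zero A B
dominates⇔above (suc k) (inside ∷ A) (inside ∷ B) =
  ⇔-sym (above-drop-zero∷ k (elems B) (elems A)) ⇔-∘ dominates⇔above (suc k) A B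
dominates⇔above k (inside ∷ A) (outside ∷ B) =
  ⇔-sym (above-drop-zero∷ k (elems B) (elems A)) ⇔-∘ dominates⇔above (suc k) A B
dominates⇔above k (outside ∷ A) (outside ∷ B) =
  ⇔-sym (above-drop-map-suc k (elems B) (elems A)) ⇔-∘ dominates⇔above k A B
dominates⇔above zero (outside ∷ A) (inside ∷ B) = mk⇔ (λ ()) (λ p → ⊥-elim (¬above-zero∷ p))
dominates⇔above (suc k) (outside ∷ A) (inside ∷ B) =
  ⇔-sym (above-drop-map-suc k (elems B) (elems A)) ⇔-∘ dominates⇔above k A B

⊑ₛ⇔dominates : (A B : Subset n) → A ⊑ₛ B ⇔ Dominates 0 A B
⊑ₛ⇔dominates A B =
  ⇔-sym (dominates⇔above 0 A B) ⇔-∘ mk⇔ lookup⇒prefix prefix⇒lookup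

module Tableau (m : ℕ) where

  weightᵀ : T (suc m) → ℕ
  weightᵀ = weight ∘ proj₁

  ⊑⇒dominates : ∀ (x y : T (suc m)) → x ⊑ y → Dominates 0 (proj₁ x) (proj₁ y)
  ⊑⇒dominates x y = Equivalence.to (⊑ₛ⇔dominates (proj₁ x) (proj₁ y))

  dominates⇒⊑ : ∀ (x y : T (suc m)) → Dominates 0 (proj₁ x) (proj₁ y) → x ⊑ y
  dominates⇒⊑ x y = Equivalence.from (⊑ₛ⇔dominates (proj₁ x) (proj₁ y))

  bot top : T (suc m)
  bot = ⊤ , fzero , here
  top = ⁅ fromℕ m ⁆ , fromℕ m , x∈⁅x⁆ (fromℕ m)

  bot-least : ∀ x → bot ⊑ x
  bot-least x = dominates⇒⊑ bot x (⊤-dominates 0 (proj₁ x))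

  top-greatest : ∀ x → x ⊑ top
  top-greatest x = dominates⇒⊑ x top (nonempty-dominates-⁅last⁆ 0 (proj₁ x) (proj₂ x))

  coverᵀ : ∀ {a b : T (suc m)} → a ⊏ b → ∃ λ z → a ⊑ z × z ⊑ b × suc (weightᵀ z) ≡ weightᵀ a
  coverᵀ {a} {b} (a⊑b , a≢b) with Z , aZ , Zb , e ← cover _ _ (⊑⇒dominates a b a⊑b) a≢b =
    z , dominates⇒⊑ a z aZ , dominates⇒⊑ z b Zb , e
    where
    z : T (suc m)
    z = Z , dominates-nonempty Z (proj₁ b) Zb (proj₂ b)

  weightᵀ-antitone : ∀ {x y : T (suc m)} → x ⊑ y → weightᵀ y ≤ weightᵀ x
  weightᵀ-antitone {x} {y} x⊑y = weight-antitone (proj₁ x) (proj₁ y) (⊑⇒dominates x y x⊑y)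

  weightᵀ-reflects : ∀ {x y : T (suc m)} → x ⊑ y → weightᵀ x ≤ weightᵀ y → x ≈T y
  weightᵀ-reflects {x} {y} x⊑y = dominates∧weight-≤⇒≡ (proj₁ x) (proj₁ y) (⊑⇒dominates x y x⊑y)

  open WeightedPoset _≈T_ _⊑_ weightᵀ refl (cong weight)
    (λ {x} {y} → weightᵀ-antitone {x} {y}) (λ {x} {y} → weightᵀ-reflects {x} {y})
    using (module Bounded)
  module Chains = Bounded bot top bot-least top-greatest (λ {a} {b} → coverᵀ {a} {b})
  open Chains public using (bot-minimal; top-maximal)

  maximalChain-length : ∀ c → MaximalChain c → length c ≡ suc (suc m) C 2
  maximalChain-length c c-maximal = +-cancelʳ-≡ 1 _ _ (begin
    length c + 1           ≡⟨ cong (length c +_) (weight-⁅last⁆ m) ⟨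
    length c + weightᵀ top ≡⟨ Chains.maximalChain-length c c-maximal ⟩
    suc (weightᵀ bot)      ≡⟨ cong suc (weight-⊤ (suc m)) ⟩
    suc (suc (suc m) C 2)  ≡⟨ +-comm 1 _ ⟩
    suc (suc m) C 2 + 1    ∎)
    where open ≡-Reasoning

proposition6p8 : ∀ (n : ℕ) → 1 ≤ n →
    (∃ λ (m : T n) → Minimal m × (∀ m' → Minimal m' → m' ≈T m))
    × (∃ λ (M : T n) → Maximal M × (∀ M' → Maximal M' → M' ≈T M))
    × (∀ (c : List (T n)) → MaximalChain c → length c ≡ (suc n) C 2)
proposition6p8 (suc m) _ =
    (bot , bot-minimal , λ x x-minimal → sym (x-minimal bot (bot-least x)))
  , (top , top-maximal , λ x x-maximal → sym (x-maximal top (top-greatest x)))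
  , maximalChain-length
  where open Tableau m
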